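{- For every finite simple graph $G$, the following statements are equivalent: (1) $G$ is domishold; (2) the dominating set hypergraph $\mathcal{D}(G)$ is threshold; (3) the dominating set hypergraph $\mathcal{D}(G)$ is $2$-asummable.
   Context: A hypergraph $\mathcal{H}=(V,E)$ consists of a finite vertex set $V$ and a set $E$ of subsets of $V$ (hyperedges). A set $X\subseteq V$ is independent in $\mathcal{H}$ if it contains no hyperedge, and dependent otherwise. $\mathcal{H}$ is threshold if there exist $w:V\to\mathbb{Z}_{\ge0}$ and $t\in\mathbb{Z}_{\ge0}$ such that for every $X\subseteq V$, $\sum_{x\in X}w(x)\ge t$ if and only if $X$ contains some hyperedge. $\mathcal{H}$ is $2$-asummable if there are no (not necessarily distinct) independent sets $A_1,A_2$ and dependent sets $B_1,B_2$ with $\chi^{A_1}+\chi^{A_2}=\chi^{B_1}+\chi^{B_2}$, where $\chi^S$ is the characteristic vector of $S$. A dominating set of a graph $G$ is a set $D\subseteq V(G)$ such that every vertex is in $D$ or has a neighbor in $D$. $G=(V,E)$ is domishold if there exist $w:V\to\mathbb{Z}_{\ge0}$ and $t\in\mathbb{Z}_{\ge0}$ such that for every $X\subseteq V$, $\sum_{x\in X}w(x)\ge t$ if and only if $X$ is a dominating set. The dominating set hypergraph $\mathcal{D}(G)$ has vertex set $V(G)$ and as hyperedges exactly the inclusion-minimal dominating sets of $G$. -}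

module Defs where

open import Data.Nat using (ℕ; zero; suc; _+_; _≥_)
open import Data.Bool using (Bool; true; false; if_then_else_)
open import Data.Fin using (Fin; zero; suc)
open import Data.Fin.Subset using (Subset; _∈_; _⊆_)
open import Data.Vec using (Vec; []; _∷_; lookup)
open import Data.Product using (Σ; ∃; ∃-syntax; _×_)
open import Data.Sum using (_⊎_)
open import Relation.Nullary using (¬_)
open import Relation.Binary.PropositionalEquality using (_≡_)
open import Function.Bundles using (_⇔_)

record Graph (n : ℕ) : Set where
  field
    adj     : Fin n → Fin n → Bool
    sym     : ∀ u v → adj u v ≡ adj v u
    irrefl  : ∀ v → adj v v ≡ false

open Graph public

Dominating : ∀ {n} → Graph n → Subset n → Set
Dominating G D = ∀ v → v ∈ D ⊎ (∃[ u ] (adj G v u ≡ true × u ∈ D))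

wsum : ∀ {n} → (Fin n → ℕ) → Subset n → ℕ
wsum {zero}  w []      = 0
wsum {suc n} w (b ∷ X) = (if b then w zero else 0) + wsum (λ i → w (suc i)) X

Domishold : ∀ {n} → Graph n → Set
Domishold {n} G = Σ (Fin n → ℕ) λ w → Σ ℕ λ t →
  ∀ (X : Subset n) → (wsum w X ≥ t) ⇔ Dominating G X

record Hypergraph (n : ℕ) : Set₁ where
  field
    Edge : Subset n → Set

open Hypergraph public

Dependent : ∀ {n} → Hypergraph n → Subset n → Set
Dependent H X = ∃[ e ] (Edge H e × e ⊆ X)

Independent : ∀ {n} → Hypergraph n → Subset n → Set
Independent H X = ¬ Dependent H X

Threshold : ∀ {n} → Hypergraph n → Set
Threshold {n} H = Σ (Fin n → ℕ) λ w → Σ ℕ λ t →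
  ∀ (X : Subset n) → (wsum w X ≥ t) ⇔ Dependent H X

χ : ∀ {n} → Subset n → Fin n → ℕ
χ X i = if lookup X i then 1 else 0

TwoAsummable : ∀ {n} → Hypergraph n → Set
TwoAsummable {n} H = ¬ (Σ (Subset n) λ A₁ → Σ (Subset n) λ A₂ →
  Σ (Subset n) λ B₁ → Σ (Subset n) λ B₂ →
  Independent H A₁ × Independent H A₂ × Dependent H B₁ × Dependent H B₂ ×
  (∀ i → χ A₁ i + χ A₂ i ≡ χ B₁ i + χ B₂ i))

MinimalDominating : ∀ {n} → Graph n → Subset n → Set
MinimalDominating {n} G D =
  Dominating G D × (∀ (D' : Subset n) → D' ⊆ D → Dominating G D' → D' ≡ D)

𝒟 : ∀ {n} → Graph n → Hypergraph n
𝒟 G = record { Edge = MinimalDominating G }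

-- (1) ⇔ (2): a set is dependent in 𝒟(G) exactly when it is dominating, since
-- every dominating set contains a minimal one; so both notions ask for the same
-- weights.  (2) ⇒ (3) holds for every hypergraph: balanced families have equal
-- total weight, but two independent sets weigh less than 2t and two dependent
-- sets at least 2t.
--
-- We work with induced subgraphs G[U] and prove,
-- by well-founded induction on U, that if domination in G[U] admits no
-- exchange (2-asummability) then it is threshold with positive weights:
--  * if two nonadjacent vertices had incomparable neighbourhoods, trading them
--    between their non-neighbourhoods would give an exchange; descending along
--    shrinking neighbourhoods thus yields a pivot u, whose non-neighbours see all
--    its neighbours;
--  * if u is isolated, it gets weight larger than all others together;
--  * otherwise G[U] is the join of the non-neighbours and the neighbours of u;
--    by an exchange argument on pairs, on one side every two vertices dominate,
--    and the threshold structure of the other side extends to the join.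
module Submission where

open import Defs
open import Data.Nat using (ℕ)
open import Data.Product using (_×_)
open import Function.Bundles using (_⇔_)

open import Data.Nat using (zero; suc; _+_; _*_; _≤_; _<_; _≥_; z≤n; s≤s)
open import Data.Nat.Properties
open import Data.Bool using (Bool; true; false; _∨_; if_then_else_)
import Data.Bool as Bool
open import Data.Fin using (Fin; zero; suc)
open import Data.Fin.Properties using (any?; all?)
import Data.Fin as Fin
open import Data.Fin.Subset
  using (Subset; inside; outside; _∈_; _∉_; _⊆_; _⊂_; ⊥; ⊤; ⁅_⁆; ∁; _∩_; _∪_; _─_; _-_; Nonempty)
open import Data.Fin.Subset.Properties
open import Data.Fin.Subset.Induction using (⊂-wellFounded)
open import Data.Vec using ([]; _∷_; lookup; tabulate)
open import Data.Vec.Properties using (lookup∘tabulate; []=⇒lookup; lookup⇒[]=)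
open import Data.Vec.Base using (here; there)
open import Data.Product using (∃-syntax; _,_; proj₁; proj₂)
open import Data.Sum using (_⊎_; inj₁; inj₂; [_,_]′; swap)
open import Relation.Nullary using (¬_; Dec; yes; no; does; contradiction)
open import Relation.Nullary.Decidable
  using (dec-true; dec-false; decidable-stable; _×-dec_; _⊎-dec_; _→-dec_; ¬?)
open import Relation.Binary.PropositionalEquality
  using (_≡_; _≢_; ≢-sym; refl; trans; cong; cong₂; subst; module ≡-Reasoning)
  renaming (sym to ≡-sym)
open import Induction.WellFounded using (Acc; acc)
open import Function using (_∘_)
open import Function.Bundles using (mk⇔; Equivalence)
open Equivalence using (to; from)
open import Function.Properties.Equivalence using () renaming (trans to ⇔-trans; sym to ⇔-sym)
open import Algebra.Properties.CommutativeSemigroup +-commutativeSemigroup using (interchange)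

private variable
  n : ℕ

both-hold : ∀ {A B : Set} → A → B → A ⇔ B
both-hold a b = mk⇔ (λ _ → b) (λ _ → a)

neither-holds : ∀ {A B : Set} → ¬ A → ¬ B → A ⇔ B
neither-holds ¬a ¬b = mk⇔ (λ a → contradiction a ¬a) (λ b → contradiction b ¬b)

half-≤ : ∀ {a b} → a + a ≤ b + b → a ≤ b
half-≤ a+a≤b+b = ≮⇒≥ λ b<a → <⇒≱ (+-mono-< b<a b<a) a+a≤b+b

∈-tabulate⁺ : ∀ {f : Fin n → Bool} {x} → f x ≡ true → x ∈ tabulate f
∈-tabulate⁺ {f = f} {x} fx = lookup⇒[]= x (tabulate f) (trans (lookup∘tabulate f x) fx)

∈-tabulate⁻ : ∀ {f : Fin n → Bool} {x} → x ∈ tabulate f → f x ≡ true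
∈-tabulate⁻ {f = f} {x} x∈ = trans (≡-sym (lookup∘tabulate f x)) ([]=⇒lookup x∈)

x∈p─q⇒x∉q : ∀ {x : Fin n} (p q : Subset n) → x ∈ p ─ q → x ∉ q
x∈p─q⇒x∉q (_ ∷ p) (outside ∷ q) here          ()
x∈p─q⇒x∉q (_ ∷ p) (_       ∷ q) (there x∈p─q) (there x∈q) = x∈p─q⇒x∉q p q x∈p─q x∈q

Disjoint : Subset n → Subset n → Set
Disjoint p q = ∀ {x} → x ∈ p → x ∉ q

disjoint-tail : ∀ {a b} {p q : Subset n} → Disjoint (a ∷ p) (b ∷ q) → Disjoint p q
disjoint-tail p#q x∈p x∈q = p#q (there x∈p) (there x∈q)

singletons-disjoint : ∀ {x y : Fin n} → x ≢ y → Disjoint ⁅ x ⁆ ⁅ y ⁆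
singletons-disjoint {y = y} x≢y z∈⁅x⁆ z∈⁅y⁆ =
  x≢y (trans (≡-sym (x∈⁅y⁆⇒x≡y _ z∈⁅x⁆)) (x∈⁅y⁆⇒x≡y y z∈⁅y⁆))

outside-disjoint : ∀ {x : Fin n} {p} → x ∉ p → Disjoint ⁅ x ⁆ p
outside-disjoint {x = x} x∉p y∈⁅x⁆ y∈p = x∉p (subst (_∈ _) (x∈⁅y⁆⇒x≡y x y∈⁅x⁆) y∈p)

removed-disjoint : ∀ (x : Fin n) p → Disjoint ⁅ x ⁆ (p - x)
removed-disjoint x p y∈⁅x⁆ y∈p-x = x∈p─q⇒x∉q p ⁅ x ⁆ y∈p-x y∈⁅x⁆

⁅⁆-⊆ : ∀ {x : Fin n} {p} → x ∈ p → ⁅ x ⁆ ⊆ p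
⁅⁆-⊆ {x = x} {p} x∈p y∈⁅x⁆ = subst (_∈ p) (≡-sym (x∈⁅y⁆⇒x≡y x y∈⁅x⁆)) x∈p

∪-⊆ : ∀ {p q r : Subset n} → p ⊆ r → q ⊆ r → p ∪ q ⊆ r
∪-⊆ {p = p} {q} p⊆r q⊆r x∈ = [ p⊆r , q⊆r ]′ (x∈p∪q⁻ p q x∈)

pair-⊆ : ∀ {x y : Fin n} {p} → x ∈ p → y ∈ p → ⁅ x ⁆ ∪ ⁅ y ⁆ ⊆ p
pair-⊆ x∈p y∈p = ∪-⊆ (⁅⁆-⊆ x∈p) (⁅⁆-⊆ y∈p)

remove-mono : ∀ {p q : Subset n} {x} → p ⊆ q → p - x ⊆ q - x
remove-mono {p = p} {q} {x} p⊆q y∈p-x =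
  x∈p∧x∉q⇒x∈p─q (p⊆q (p─q⊆p p ⁅ x ⁆ y∈p-x)) (x∈p─q⇒x∉q p ⁅ x ⁆ y∈p-x)

∈pair₁ : ∀ (x y : Fin n) → x ∈ ⁅ x ⁆ ∪ ⁅ y ⁆
∈pair₁ x y = x∈p∪q⁺ (inj₁ (x∈⁅x⁆ x))

∈pair₂ : ∀ (x y : Fin n) → y ∈ ⁅ x ⁆ ∪ ⁅ y ⁆
∈pair₂ x y = x∈p∪q⁺ {p = ⁅ x ⁆} (inj₂ (x∈⁅x⁆ y))

insert-remove : ∀ {x : Fin n} {p} → x ∈ p → ⁅ x ⁆ ∪ (p - x) ≡ p
insert-remove {x = x} {p} x∈p = ⊆-antisym (∪-⊆ (⁅⁆-⊆ x∈p) (p─q⊆p p ⁅ x ⁆)) p⊆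
  where
    p⊆ : p ⊆ ⁅ x ⁆ ∪ (p - x)
    p⊆ {y} y∈p with y Fin.≟ x
    ... | yes refl = x∈p∪q⁺ (inj₁ (x∈⁅x⁆ x))
    ... | no y≢x   = x∈p∪q⁺ (inj₂ (x∈p∧x≢y⇒x∈p-y y∈p y≢x))

remove-insert : ∀ {x : Fin n} {p} → x ∉ p → (⁅ x ⁆ ∪ p) - x ≡ p
remove-insert {x = x} {p} x∉p = ⊆-antisym ⊆p p⊆
  where
    ⊆p : (⁅ x ⁆ ∪ p) - x ⊆ p
    ⊆p y∈ with x∈p∪q⁻ ⁅ x ⁆ p (p─q⊆p (⁅ x ⁆ ∪ p) ⁅ x ⁆ y∈)
    ... | inj₁ y∈⁅x⁆ = contradiction y∈⁅x⁆ (x∈p─q⇒x∉q (⁅ x ⁆ ∪ p) ⁅ x ⁆ y∈)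
    ... | inj₂ y∈p   = y∈p
    p⊆ : p ⊆ (⁅ x ⁆ ∪ p) - x
    p⊆ y∈p = x∈p∧x≢y⇒x∈p-y (x∈p∪q⁺ {p = ⁅ x ⁆} (inj₂ y∈p)) (λ { refl → x∉p y∈p })


Balanced : (A₁ A₂ B₁ B₂ : Subset n) → Set
Balanced A₁ A₂ B₁ B₂ = ∀ i → χ A₁ i + χ A₂ i ≡ χ B₁ i + χ B₂ i

χ-∈ : ∀ {p : Subset n} {i} → i ∈ p → χ p i ≡ 1
χ-∈ i∈p rewrite []=⇒lookup i∈p = refl

χ-∉ : ∀ {p : Subset n} {i} → i ∉ p → χ p i ≡ 0
χ-∉ {p = p} {i} i∉p with lookup p i in eq
... | true  = contradiction (lookup⇒[]= i p eq) i∉p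
... | false = refl

χ-∪ : ∀ {p q : Subset n} → Disjoint p q → ∀ i → χ (p ∪ q) i ≡ χ p i + χ q i
χ-∪ {p = p} {q} p#q i with i ∈? p | i ∈? q
... | yes i∈p | _       =
  trans (χ-∈ (x∈p∪q⁺ {q = q} (inj₁ i∈p))) (≡-sym (cong₂ _+_ (χ-∈ i∈p) (χ-∉ (p#q i∈p))))
... | no i∉p  | yes i∈q =
  trans (χ-∈ (x∈p∪q⁺ {p = p} (inj₂ i∈q))) (≡-sym (cong₂ _+_ (χ-∉ i∉p) (χ-∈ i∈q)))
... | no i∉p  | no i∉q  =
  trans (χ-∉ ([ i∉p , i∉q ]′ ∘ x∈p∪q⁻ p q)) (≡-sym (cong₂ _+_ (χ-∉ i∉p) (χ-∉ i∉q)))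

pair-balanced : ∀ {a b c d : Fin n} → a ≢ b → c ≢ d → a ≢ c → b ≢ d →
                Balanced (⁅ a ⁆ ∪ ⁅ b ⁆) (⁅ c ⁆ ∪ ⁅ d ⁆) (⁅ a ⁆ ∪ ⁅ c ⁆) (⁅ b ⁆ ∪ ⁅ d ⁆)
pair-balanced {a = a} {b} {c} {d} a≢b c≢d a≢c b≢d i = begin
  χ (⁅ a ⁆ ∪ ⁅ b ⁆) i + χ (⁅ c ⁆ ∪ ⁅ d ⁆) i
    ≡⟨ cong₂ _+_ (χ-∪ (singletons-disjoint a≢b) i) (χ-∪ (singletons-disjoint c≢d) i) ⟩
  (χ ⁅ a ⁆ i + χ ⁅ b ⁆ i) + (χ ⁅ c ⁆ i + χ ⁅ d ⁆ i)
    ≡⟨ interchange (χ ⁅ a ⁆ i) (χ ⁅ b ⁆ i) (χ ⁅ c ⁆ i) (χ ⁅ d ⁆ i) ⟩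
  (χ ⁅ a ⁆ i + χ ⁅ c ⁆ i) + (χ ⁅ b ⁆ i + χ ⁅ d ⁆ i)
    ≡⟨ cong₂ _+_ (χ-∪ (singletons-disjoint a≢c) i) (χ-∪ (singletons-disjoint b≢d) i) ⟨
  χ (⁅ a ⁆ ∪ ⁅ c ⁆) i + χ (⁅ b ⁆ ∪ ⁅ d ⁆) i          ∎
  where open ≡-Reasoning

trade-balanced : ∀ {A₁ A₂ : Subset n} {x y} → y ∈ A₁ → x ∈ A₂ → x ∉ A₁ → y ∉ A₂ →
                 Balanced A₁ A₂ (⁅ x ⁆ ∪ (A₁ - y)) (⁅ y ⁆ ∪ (A₂ - x))
trade-balanced {A₁ = A₁} {A₂} {x} {y} y∈A₁ x∈A₂ x∉A₁ y∉A₂ i = begin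
  χ A₁ i + χ A₂ i                                         ≡⟨ cong₂ _+_ (split y∈A₁) (split x∈A₂) ⟩
  (χ ⁅ y ⁆ i + χ (A₁ - y) i) + (χ ⁅ x ⁆ i + χ (A₂ - x) i) ≡⟨ interchange (χ ⁅ y ⁆ i) _ (χ ⁅ x ⁆ i) _ ⟩
  (χ ⁅ y ⁆ i + χ ⁅ x ⁆ i) + (χ (A₁ - y) i + χ (A₂ - x) i)
    ≡⟨ cong (_+ (χ (A₁ - y) i + χ (A₂ - x) i)) (+-comm (χ ⁅ y ⁆ i) (χ ⁅ x ⁆ i)) ⟩
  (χ ⁅ x ⁆ i + χ ⁅ y ⁆ i) + (χ (A₁ - y) i + χ (A₂ - x) i) ≡⟨ interchange (χ ⁅ x ⁆ i) _ (χ ⁅ y ⁆ i) _ ⟨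
  (χ ⁅ x ⁆ i + χ (A₁ - y) i) + (χ ⁅ y ⁆ i + χ (A₂ - x) i)
    ≡⟨ cong₂ _+_ (χ-∪ (outside-disjoint (x∉A₁ ∘ p─q⊆p A₁ ⁅ y ⁆)) i)
                 (χ-∪ (outside-disjoint (y∉A₂ ∘ p─q⊆p A₂ ⁅ x ⁆)) i) ⟨
  χ (⁅ x ⁆ ∪ (A₁ - y)) i + χ (⁅ y ⁆ ∪ (A₂ - x)) i         ∎
  where
    open ≡-Reasoning
    split : ∀ {z p} → z ∈ p → χ p i ≡ χ ⁅ z ⁆ i + χ (p - z) i
    split {z} {p} z∈p = trans (cong (λ q → χ q i) (≡-sym (insert-remove z∈p))) (χ-∪ (removed-disjoint z p) i)


sum-of-sums : ∀ h₁ h₂ r₁ r₂ {h r : ℕ} → h ≡ h₁ + h₂ → r ≡ r₁ + r₂ → h + r ≡ (h₁ + r₁) + (h₂ + r₂)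
sum-of-sums h₁ h₂ r₁ r₂ refl refl = interchange h₁ h₂ r₁ r₂

wsum-⊥ : ∀ (w : Fin n → ℕ) → wsum w ⊥ ≡ 0
wsum-⊥ {zero}  w = refl
wsum-⊥ {suc n} w = wsum-⊥ (w ∘ suc)

wsum-⁅⁆ : ∀ (w : Fin n → ℕ) x → wsum w ⁅ x ⁆ ≡ w x
wsum-⁅⁆ w zero    = trans (cong (w zero +_) (wsum-⊥ (w ∘ suc))) (+-identityʳ (w zero))
wsum-⁅⁆ w (suc x) = wsum-⁅⁆ (w ∘ suc) x

wsum-∪ : ∀ (w : Fin n → ℕ) p q → Disjoint p q → wsum w (p ∪ q) ≡ wsum w p + wsum w q
wsum-∪ w [] [] _ = refl
wsum-∪ w (inside ∷ p) (inside ∷ q) p#q = contradiction here (p#q here)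
wsum-∪ w (inside ∷ p) (outside ∷ q) p#q =
  sum-of-sums (w zero) 0 (wsum (w ∘ suc) p) (wsum (w ∘ suc) q) (≡-sym (+-identityʳ (w zero)))
              (wsum-∪ (w ∘ suc) p q (disjoint-tail p#q))
wsum-∪ w (outside ∷ p) (inside ∷ q) p#q =
  sum-of-sums 0 (w zero) (wsum (w ∘ suc) p) (wsum (w ∘ suc) q) refl (wsum-∪ (w ∘ suc) p q (disjoint-tail p#q))
wsum-∪ w (outside ∷ p) (outside ∷ q) p#q = wsum-∪ (w ∘ suc) p q (disjoint-tail p#q)

wsum-mono : ∀ (w : Fin n → ℕ) {p q} → p ⊆ q → wsum w p ≤ wsum w q
wsum-mono w {[]}          {[]}          p⊆q = ≤-refl
wsum-mono w {inside ∷ p}  {inside ∷ q}  p⊆q = +-monoʳ-≤ (w zero) (wsum-mono (w ∘ suc) (drop-∷-⊆ p⊆q))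
wsum-mono w {inside ∷ p}  {outside ∷ q} p⊆q with p⊆q here
... | ()
wsum-mono w {outside ∷ p} {b ∷ q}       p⊆q = +-mono-≤ z≤n (wsum-mono (w ∘ suc) (drop-∷-⊆ p⊆q))

wsum-cong : ∀ {w w′ : Fin n → ℕ} p → (∀ {x} → x ∈ p → w x ≡ w′ x) → wsum w p ≡ wsum w′ p
wsum-cong []            _ = refl
wsum-cong (inside ∷ p)  e = cong₂ _+_ (e here) (wsum-cong p (e ∘ there))
wsum-cong (outside ∷ p) e = wsum-cong p (e ∘ there)

wsum-+ : ∀ (f g : Fin n → ℕ) p → wsum (λ i → f i + g i) p ≡ wsum f p + wsum g p
wsum-+ f g []            = refl
wsum-+ f g (inside ∷ p)  =
  sum-of-sums (f zero) (g zero) (wsum (f ∘ suc) p) (wsum (g ∘ suc) p) refl (wsum-+ (f ∘ suc) (g ∘ suc) p)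
wsum-+ f g (outside ∷ p) = wsum-+ (f ∘ suc) (g ∘ suc) p

wsum-balanced : ∀ (w : Fin n → ℕ) A₁ A₂ B₁ B₂ → Balanced A₁ A₂ B₁ B₂ →
                wsum w A₁ + wsum w A₂ ≡ wsum w B₁ + wsum w B₂
wsum-balanced w [] [] [] [] _ = refl
wsum-balanced w (a₁ ∷ A₁) (a₂ ∷ A₂) (b₁ ∷ B₁) (b₂ ∷ B₂) bal = begin
  (select a₁ + wsum w′ A₁) + (select a₂ + wsum w′ A₂) ≡⟨ interchange (select a₁) _ (select a₂) _ ⟩
  (select a₁ + select a₂) + (wsum w′ A₁ + wsum w′ A₂)
    ≡⟨ cong₂ _+_ head (wsum-balanced w′ A₁ A₂ B₁ B₂ (bal ∘ suc)) ⟩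
  (select b₁ + select b₂) + (wsum w′ B₁ + wsum w′ B₂) ≡⟨ interchange (select b₁) (select b₂) _ _ ⟩
  (select b₁ + wsum w′ B₁) + (select b₂ + wsum w′ B₂) ∎
  where
    open ≡-Reasoning
    w′ : Fin _ → ℕ
    w′ = w ∘ suc
    select : Bool → ℕ
    select b = if b then w zero else 0
    indicator : Bool → ℕ
    indicator b = if b then 1 else 0
    select-χ : ∀ b → select b ≡ indicator b * w zero
    select-χ true  = ≡-sym (+-identityʳ (w zero))
    select-χ false = refl
    head : select a₁ + select a₂ ≡ select b₁ + select b₂
    head = begin
      select a₁ + select a₂                           ≡⟨ cong₂ _+_ (select-χ a₁) (select-χ a₂) ⟩
      indicator a₁ * w zero + indicator a₂ * w zero   ≡⟨ *-distribʳ-+ (w zero) (indicator a₁) (indicator a₂) ⟨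
      (indicator a₁ + indicator a₂) * w zero          ≡⟨ cong (_* w zero) (bal zero) ⟩
      (indicator b₁ + indicator b₂) * w zero          ≡⟨ *-distribʳ-+ (w zero) (indicator b₁) (indicator b₂) ⟩
      indicator b₁ * w zero + indicator b₂ * w zero   ≡⟨ cong₂ _+_ (select-χ b₁) (select-χ b₂) ⟨
      select b₁ + select b₂                           ∎

wsum-two : ∀ (w : Fin n → ℕ) {x y p} → x ≢ y → x ∈ p → y ∈ p → w x + w y ≤ wsum w p
wsum-two w {x} {y} {p} x≢y x∈p y∈p = begin
  w x + w y                    ≡⟨ cong₂ _+_ (wsum-⁅⁆ w x) (wsum-⁅⁆ w y) ⟨
  wsum w ⁅ x ⁆ + wsum w ⁅ y ⁆  ≡⟨ wsum-∪ w ⁅ x ⁆ ⁅ y ⁆ (singletons-disjoint x≢y) ⟨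
  wsum w (⁅ x ⁆ ∪ ⁅ y ⁆)       ≤⟨ wsum-mono w (pair-⊆ x∈p y∈p) ⟩
  wsum w p                     ∎
  where open ≤-Reasoning

wsum-remove : ∀ (w : Fin n → ℕ) {x p} → x ∈ p → wsum w p ≡ w x + wsum w (p - x)
wsum-remove w {x} {p} x∈p = begin
  wsum w p                         ≡⟨ cong (wsum w) (insert-remove x∈p) ⟨
  wsum w (⁅ x ⁆ ∪ (p - x))         ≡⟨ wsum-∪ w ⁅ x ⁆ (p - x) (removed-disjoint x p) ⟩
  wsum w ⁅ x ⁆ + wsum w (p - x)    ≡⟨ cong (_+ wsum w (p - x)) (wsum-⁅⁆ w x) ⟩
  w x + wsum w (p - x)             ∎
  where open ≡-Reasoning


module _ {n : ℕ} (G : Graph n) where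

  infix 4 _~_
  _~_ : Fin n → Fin n → Set
  u ~ v = adj G u v ≡ true

  _~?_ : ∀ u v → Dec (u ~ v)
  u ~? v = adj G u v Bool.≟ true

  ~-sym : ∀ {u v} → u ~ v → v ~ u
  ~-sym {u} {v} u~v = trans (sym G v u) u~v

  ~-irrefl : ∀ {v} → ¬ v ~ v
  ~-irrefl {v} v~v with trans (≡-sym v~v) (irrefl G v)
  ... | ()

  ~⇒≢ : ∀ {u v} → u ~ v → u ≢ v
  ~⇒≢ u~v refl = ~-irrefl u~v

  N : Fin n → Subset n
  N u = tabulate (adj G u)

  DominatedBy : Subset n → Fin n → Set
  DominatedBy D v = v ∈ D ⊎ ∃[ u ] (v ~ u × u ∈ D)

  -- D dominates every vertex of U, i.e. D ⊆ U is a dominating set of the induced subgraph G[U].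
  DominatesIn : Subset n → Subset n → Set
  DominatesIn U D = ∀ v → v ∈ U → DominatedBy D v

  dominated? : ∀ D v → Dec (DominatedBy D v)
  dominated? D v = (v ∈? D) ⊎-dec any? λ u → (v ~? u) ×-dec (u ∈? D)

  dominates-in? : ∀ U D → Dec (DominatesIn U D)
  dominates-in? U D = all? λ v → (v ∈? U) →-dec dominated? D v

  dominated-mono : ∀ {D D′ v} → D ⊆ D′ → DominatedBy D v → DominatedBy D′ v
  dominated-mono D⊆D′ (inj₁ v∈D)             = inj₁ (D⊆D′ v∈D)
  dominated-mono D⊆D′ (inj₂ (u , v~u , u∈D)) = inj₂ (u , v~u , D⊆D′ u∈D)

  dominates-mono : ∀ {U D D′} → D ⊆ D′ → DominatesIn U D → DominatesIn U D′
  dominates-mono D⊆D′ dom v = dominated-mono D⊆D′ ∘ dom v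

  dominates-restrict : ∀ {U V D} → V ⊆ U → DominatesIn U D → DominatesIn V D
  dominates-restrict V⊆U dom v = dom v ∘ V⊆U

  record ThresholdIn (U : Subset n) : Set where
    field
      weight    : Fin n → ℕ
      threshold : ℕ
      positive  : ∀ {v} → v ∈ U → 1 ≤ weight v
      realises  : ∀ {D} → D ⊆ U → wsum weight D ≥ threshold ⇔ DominatesIn U D

  record Exchange (U : Subset n) : Set where
    field
      A₁ A₂ B₁ B₂  : Subset n
      A₁⊆U         : A₁ ⊆ U
      A₂⊆U         : A₂ ⊆ U
      B₁⊆U         : B₁ ⊆ U
      B₂⊆U         : B₂ ⊆ U
      A₁-fails     : ¬ DominatesIn U A₁
      A₂-fails     : ¬ DominatesIn U A₂
      B₁-dominates : DominatesIn U B₁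
      B₂-dominates : DominatesIn U B₂
      balanced     : Balanced A₁ A₂ B₁ B₂

  TwoAsummableIn : Subset n → Set
  TwoAsummableIn U = ¬ Exchange U

  asummable-transfer : ∀ {U U′} (f : Subset n → Subset n) (c : Fin n → ℕ) →
    (∀ {D} → D ⊆ U′ → f D ⊆ U) →
    (∀ {D} → D ⊆ U′ → DominatesIn U (f D) ⇔ DominatesIn U′ D) →
    (∀ {D} → D ⊆ U′ → ∀ i → χ (f D) i ≡ χ D i + c i) →
    TwoAsummableIn U → TwoAsummableIn U′
  asummable-transfer {U} {U′} f c f⊆ f-dom f-χ asummable ex = asummable record
    { A₁ = f A₁ ; A₂ = f A₂ ; B₁ = f B₁ ; B₂ = f B₂
    ; A₁⊆U = f⊆ A₁⊆U ; A₂⊆U = f⊆ A₂⊆U ; B₁⊆U = f⊆ B₁⊆U ; B₂⊆U = f⊆ B₂⊆U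
    ; A₁-fails = A₁-fails ∘ to (f-dom A₁⊆U)
    ; A₂-fails = A₂-fails ∘ to (f-dom A₂⊆U)
    ; B₁-dominates = from (f-dom B₁⊆U) B₁-dominates
    ; B₂-dominates = from (f-dom B₂⊆U) B₂-dominates
    ; balanced = shifted
    }
    where
      open Exchange ex
      shifted : Balanced (f A₁) (f A₂) (f B₁) (f B₂)
      shifted i = begin
        χ (f A₁) i + χ (f A₂) i             ≡⟨ cong₂ _+_ (f-χ A₁⊆U i) (f-χ A₂⊆U i) ⟩
        (χ A₁ i + c i) + (χ A₂ i + c i)     ≡⟨ interchange (χ A₁ i) (c i) (χ A₂ i) (c i) ⟩
        (χ A₁ i + χ A₂ i) + (c i + c i)     ≡⟨ cong (_+ (c i + c i)) (balanced i) ⟩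
        (χ B₁ i + χ B₂ i) + (c i + c i)     ≡⟨ interchange (χ B₁ i) (c i) (χ B₂ i) (c i) ⟨
        (χ B₁ i + c i) + (χ B₂ i + c i)     ≡⟨ cong₂ _+_ (f-χ B₁⊆U i) (f-χ B₂⊆U i) ⟨
        χ (f B₁) i + χ (f B₂) i             ∎
        where open ≡-Reasoning

  ∈N⁺ : ∀ {u v} → u ~ v → v ∈ N u
  ∈N⁺ = ∈-tabulate⁺

  ∈N⁻ : ∀ {u v} → v ∈ N u → u ~ v
  ∈N⁻ = ∈-tabulate⁻


  Far : Subset n → Fin n → Subset n
  Far U x = (U - x) ∩ ∁ (N x)

  far⁺ : ∀ {U x y} → y ∈ U → y ≢ x → ¬ x ~ y → y ∈ Far U x
  far⁺ y∈U y≢x x≁y = x∈p∩q⁺ (x∈p∧x≢y⇒x∈p-y y∈U y≢x , x∉p⇒x∈∁p (x≁y ∘ ∈N⁻))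

  far⁻ : ∀ {U x y} → y ∈ Far U x → y ∈ U × y ≢ x × ¬ x ~ y
  far⁻ {U} {x} y∈ with x∈p∩q⁻ (U - x) (∁ (N x)) y∈
  ... | y∈U-x , y∈∁N =
    p─q⊆p U ⁅ x ⁆ y∈U-x , x∉⁅y⁆⇒x≢y (x∈p─q⇒x∉q U ⁅ x ⁆ y∈U-x) , x∈∁p⇒x∉p y∈∁N ∘ ∈N⁺

  far-fails : ∀ {U x} → x ∈ U → ¬ DominatesIn U (Far U x)
  far-fails x∈U dom with dom _ x∈U
  ... | inj₁ x∈far            = proj₁ (proj₂ (far⁻ x∈far)) refl
  ... | inj₂ (y , x~y , y∈far) = proj₂ (proj₂ (far⁻ y∈far)) x~y

  Traded : Subset n → Fin n → Fin n → Subset n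
  Traded U x y = ⁅ x ⁆ ∪ (Far U x - y)

  traded-⊆ : ∀ {U x y} → x ∈ U → Traded U x y ⊆ U
  traded-⊆ {U} {x} {y} x∈U = ∪-⊆ (⁅⁆-⊆ x∈U) (proj₁ ∘ far⁻ ∘ p─q⊆p (Far U x) ⁅ y ⁆)

  traded-dominates : ∀ {U x y z} → x ∈ U → x ≢ y → ¬ x ~ y → z ∈ U → y ~ z → ¬ x ~ z →
                     DominatesIn U (Traded U x y)
  traded-dominates {U} {x} {y} {z} x∈U x≢y x≁y z∈U y~z x≁z v v∈U
    with v Fin.≟ x | x ~? v | v Fin.≟ y
  ... | yes refl | _      | _        = inj₁ (x∈p∪q⁺ (inj₁ (x∈⁅x⁆ x)))
  ... | no _     | yes x~v | _       = inj₂ (x , ~-sym x~v , x∈p∪q⁺ (inj₁ (x∈⁅x⁆ x)))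
  ... | no _     | no _    | yes refl = inj₂ (z , y~z , x∈p∪q⁺ {p = ⁅ x ⁆} (inj₂ z∈))
    where
      z∈ : z ∈ Far U x - y
      z∈ = x∈p∧x≢y⇒x∈p-y (far⁺ z∈U (λ { refl → x≁y (~-sym y~z) }) x≁z) (≢-sym (~⇒≢ y~z))
  ... | no v≢x   | no x≁v  | no v≢y  =
    inj₁ (x∈p∪q⁺ {p = ⁅ x ⁆} (inj₂ (x∈p∧x≢y⇒x∈p-y (far⁺ v∈U v≢x x≁v) v≢y)))

  incomparable-exchange : ∀ {U u s z r} → u ∈ U → s ∈ U → u ≢ s → ¬ u ~ s →
    z ∈ U → s ~ z → ¬ u ~ z → r ∈ U → u ~ r → ¬ s ~ r → Exchange U
  incomparable-exchange {U} {u} {s} u∈U s∈U u≢s u≁s z∈U s~z u≁z r∈U u~r s≁r = record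
    { A₁ = Far U u ; A₂ = Far U s ; B₁ = Traded U u s ; B₂ = Traded U s u
    ; A₁⊆U = proj₁ ∘ far⁻ ; A₂⊆U = proj₁ ∘ far⁻
    ; B₁⊆U = traded-⊆ u∈U ; B₂⊆U = traded-⊆ s∈U
    ; A₁-fails = far-fails u∈U ; A₂-fails = far-fails s∈U
    ; B₁-dominates = traded-dominates u∈U u≢s u≁s z∈U s~z u≁z
    ; B₂-dominates = traded-dominates s∈U (≢-sym u≢s) (u≁s ∘ ~-sym) r∈U u~r s≁r
    ; balanced = trade-balanced (far⁺ s∈U (≢-sym u≢s) u≁s) (far⁺ u∈U u≢s (u≁s ∘ ~-sym))
                   (λ u∈ → proj₁ (proj₂ (far⁻ u∈)) refl) (λ s∈ → proj₁ (proj₂ (far⁻ s∈)) refl)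
    }

  Pivot : Subset n → Fin n → Set
  Pivot U u = ∀ {s} → s ∈ U → s ≢ u → ¬ u ~ s → ∀ {r} → r ∈ U → u ~ r → s ~ r

  nested : ∀ {U u s r} → TwoAsummableIn U → u ∈ U → s ∈ U → u ≢ s → ¬ u ~ s →
           r ∈ U → u ~ r → ¬ s ~ r → U ∩ N s ⊆ N u
  nested {U} {u} {s} asm u∈U s∈U u≢s u≁s r∈U u~r s≁r {z} z∈ with x∈p∩q⁻ U (N s) z∈
  ... | z∈U , z∈Ns = ∈N⁺ (decidable-stable (u ~? z) λ u≁z →
    asm (incomparable-exchange u∈U s∈U u≢s u≁s z∈U (∈N⁻ z∈Ns) u≁z r∈U u~r s≁r))

  Obstruction : Subset n → Fin n → Fin n → Fin n → Set
  Obstruction U u s r = s ∈ U × s ≢ u × ¬ u ~ s × r ∈ U × u ~ r × ¬ s ~ r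

  obstruction? : ∀ U u s r → Dec (Obstruction U u s r)
  obstruction? U u s r =
    (s ∈? U) ×-dec ¬? (s Fin.≟ u) ×-dec ¬? (u ~? s) ×-dec (r ∈? U) ×-dec (u ~? r) ×-dec ¬? (s ~? r)

  pivot-or-smaller : ∀ {U u} → TwoAsummableIn U → u ∈ U →
                     Pivot U u ⊎ ∃[ s ] (s ∈ U × U ∩ N s ⊂ U ∩ N u)
  pivot-or-smaller {U} {u} asm u∈U with any? (λ s → any? (obstruction? U u s))
  ... | no none = inj₁ λ {s} s∈U s≢u u≁s {r} r∈U u~r →
    decidable-stable (s ~? r) λ s≁r → none (s , r , s∈U , s≢u , u≁s , r∈U , u~r , s≁r)
  ... | yes (s , r , s∈U , s≢u , u≁s , r∈U , u~r , s≁r) =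
    inj₂ (s , s∈U , ⊆U∩Nu , r , x∈p∩q⁺ (r∈U , ∈N⁺ u~r) , s≁r ∘ ∈N⁻ ∘ proj₂ ∘ x∈p∩q⁻ U (N s))
    where
      ⊆U∩Nu : U ∩ N s ⊆ U ∩ N u
      ⊆U∩Nu z∈ =
        x∈p∩q⁺ (proj₁ (x∈p∩q⁻ U (N s) z∈) , nested asm u∈U s∈U (≢-sym s≢u) u≁s r∈U u~r s≁r z∈)

  -- Descending along strictly shrinking neighbourhoods reaches a pivot.
  pivot-exists : ∀ {U u} → TwoAsummableIn U → u ∈ U → ∃[ v ] (v ∈ U × Pivot U v)
  pivot-exists {U} asm u∈U = descend u∈U (⊂-wellFounded _)
    where
      descend : ∀ {u} → u ∈ U → Acc _⊂_ (U ∩ N u) → ∃[ v ] (v ∈ U × Pivot U v)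
      descend {u} u∈U (acc smaller) with pivot-or-smaller asm u∈U
      ... | inj₁ pivot              = u , u∈U , pivot
      ... | inj₂ (s , s∈U , U∩Ns⊂) = descend s∈U (smaller U∩Ns⊂)


  Isolated : Subset n → Fin n → Set
  Isolated U u = ∀ {v} → v ∈ U → ¬ u ~ v

  isolated-dominates : ∀ {U u D} → u ∈ U → Isolated U u → D ⊆ U →
                       DominatesIn U D ⇔ (u ∈ D × DominatesIn (U - u) (D - u))
  isolated-dominates {U} {u} {D} u∈U isolated D⊆U = mk⇔ split join
    where
      split : DominatesIn U D → u ∈ D × DominatesIn (U - u) (D - u)
      split dom = u∈D , dom′
        where
          u∈D : u ∈ D
          u∈D with dom u u∈U
          ... | inj₁ u∈D             = u∈D
          ... | inj₂ (v , u~v , v∈D) = contradiction u~v (isolated (D⊆U v∈D))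
          dom′ : DominatesIn (U - u) (D - u)
          dom′ v v∈U-u with dom v (p─q⊆p U ⁅ u ⁆ v∈U-u)
          ... | inj₁ v∈D             = inj₁ (x∈p∧x∉q⇒x∈p─q v∈D (x∈p─q⇒x∉q U ⁅ u ⁆ v∈U-u))
          ... | inj₂ (w , v~w , w∈D) =
            inj₂ (w , v~w , x∈p∧x≢y⇒x∈p-y w∈D λ { refl → isolated (p─q⊆p U ⁅ u ⁆ v∈U-u) (~-sym v~w) })
      join : u ∈ D × DominatesIn (U - u) (D - u) → DominatesIn U D
      join (u∈D , dom′) v v∈U with v Fin.≟ u
      ... | yes refl = inj₁ u∈D
      ... | no v≢u   = dominates-mono (p─q⊆p D ⁅ u ⁆) dom′ v (x∈p∧x≢y⇒x∈p-y v∈U v≢u)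

  isolated-asummable : ∀ {U u} → u ∈ U → Isolated U u → TwoAsummableIn U → TwoAsummableIn (U - u)
  isolated-asummable {U} {u} u∈U isolated = asummable-transfer (⁅ u ⁆ ∪_) (χ ⁅ u ⁆) add-⊆ add-dom add-χ
    where
      add-⊆ : ∀ {D} → D ⊆ U - u → ⁅ u ⁆ ∪ D ⊆ U
      add-⊆ D⊆ = ∪-⊆ (⁅⁆-⊆ u∈U) (p─q⊆p U ⁅ u ⁆ ∘ D⊆)
      u∉ : ∀ {D} → D ⊆ U - u → u ∉ D
      u∉ D⊆ u∈D = x∈p─q⇒x∉q U ⁅ u ⁆ (D⊆ u∈D) (x∈⁅x⁆ u)
      add-dom : ∀ {D} → D ⊆ U - u → DominatesIn U (⁅ u ⁆ ∪ D) ⇔ DominatesIn (U - u) D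
      add-dom {D} D⊆ = ⇔-trans (isolated-dominates u∈U isolated (add-⊆ D⊆))
        (mk⇔ (λ u∈-and-dom → subst (DominatesIn (U - u)) removed (proj₂ u∈-and-dom))
             (λ dom → x∈p∪q⁺ (inj₁ (x∈⁅x⁆ u)) , subst (DominatesIn (U - u)) (≡-sym removed) dom))
        where
          removed : (⁅ u ⁆ ∪ D) - u ≡ D
          removed = remove-insert (u∉ D⊆)
      add-χ : ∀ {D} → D ⊆ U - u → ∀ i → χ (⁅ u ⁆ ∪ D) i ≡ χ D i + χ ⁅ u ⁆ i
      add-χ {D} D⊆ i = trans (χ-∪ (outside-disjoint (u∉ D⊆)) i) (+-comm (χ ⁅ u ⁆ i) (χ D i))

  -- An isolated vertex heavier than all the others together extends a threshold structure.
  isolated-threshold : ∀ {U u} → u ∈ U → Isolated U u → ThresholdIn (U - u) → ThresholdIn U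
  isolated-threshold {U} {u} u∈U isolated T = record
    { weight = w ; threshold = suc W + t ; positive = positive ; realises = realises }
    where
      open ThresholdIn T
        renaming (weight to w′; threshold to t; positive to positive′; realises to realises′)
      W : ℕ
      W = wsum w′ (U - u)
      w : Fin n → ℕ
      w v = if does (v Fin.≟ u) then suc W else w′ v
      w-u : w u ≡ suc W
      w-u rewrite dec-true (u Fin.≟ u) refl = refl
      w-other : ∀ {v} → v ≢ u → w v ≡ w′ v
      w-other {v} v≢u rewrite dec-false (v Fin.≟ u) v≢u = refl
      positive : ∀ {v} → v ∈ U → 1 ≤ w v
      positive {v} v∈U with v Fin.≟ u
      ... | yes refl = s≤s z≤n
      ... | no v≢u   = positive′ (x∈p∧x≢y⇒x∈p-y v∈U v≢u)
      wsum-without-u : ∀ D → wsum w (D - u) ≡ wsum w′ (D - u)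
      wsum-without-u D = wsum-cong (D - u) λ v∈ → w-other (x∉⁅y⁆⇒x≢y (x∈p─q⇒x∉q D ⁅ u ⁆ v∈))
      -- Containing u is necessary both for domination and for reaching the threshold.
      realises : ∀ {D} → D ⊆ U → wsum w D ≥ suc W + t ⇔ DominatesIn U D
      realises {D} D⊆U with u ∈? D
      ... | yes u∈D = ⇔-trans (⇔-trans weight-shift (realises′ (remove-mono D⊆U))) rest-dominates
        where
          rest-dominates : DominatesIn (U - u) (D - u) ⇔ DominatesIn U D
          rest-dominates = mk⇔ (λ dom′ → from (isolated-dominates u∈U isolated D⊆U) (u∈D , dom′))
                               (proj₂ ∘ to (isolated-dominates u∈U isolated D⊆U))
          heavy : wsum w D ≡ suc W + wsum w′ (D - u)
          heavy = trans (wsum-remove w u∈D) (cong₂ _+_ w-u (wsum-without-u D))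
          weight-shift : wsum w D ≥ suc W + t ⇔ wsum w′ (D - u) ≥ t
          weight-shift = mk⇔ (λ heavy≥ → +-cancelˡ-≤ (suc W) t _ (subst (suc W + t ≤_) heavy heavy≥))
                             (λ t≤ → subst (suc W + t ≤_) (≡-sym heavy) (+-monoʳ-≤ (suc W) t≤))
      ... | no u∉D = neither-holds (<⇒≱ light) (u∉D ∘ proj₁ ∘ to (isolated-dominates u∈U isolated D⊆U))
        where
          D⊆U-u : D ⊆ U - u
          D⊆U-u {v} v∈D = x∈p∧x≢y⇒x∈p-y (D⊆U v∈D) λ { refl → u∉D v∈D }
          light : wsum w D < suc W + t
          light = begin-strict
            wsum w D   ≡⟨ wsum-cong D (λ {v} v∈D → w-other λ { refl → u∉D v∈D }) ⟩
            wsum w′ D  ≤⟨ wsum-mono w′ D⊆U-u ⟩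
            W          <⟨ s≤s (m≤m+n W t) ⟩
            suc W + t  ∎
            where open ≤-Reasoning


  dominating-nonempty : ∀ {U D} → Nonempty U → DominatesIn U D → Nonempty D
  dominating-nonempty (u , u∈U) dom with dom u u∈U
  ... | inj₁ u∈D           = u , u∈D
  ... | inj₂ (v , _ , v∈D) = v , v∈D

  empty-fails : ∀ {U} → Nonempty U → ¬ DominatesIn U ⊥
  empty-fails U≠∅ dom = ∉⊥ (proj₂ (dominating-nonempty U≠∅ dom))

  record Join (U Y Z : Subset n) : Set where
    field
      Y⊆U      : Y ⊆ U
      Z⊆U      : Z ⊆ U
      cover    : ∀ {v} → v ∈ U → v ∈ Y ⊎ v ∈ Z
      disjoint : Disjoint Y Z
      complete : ∀ {y z} → y ∈ Y → z ∈ Z → y ~ z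

    other-side : ∀ {v} → v ∈ U → v ∉ Y → v ∈ Z
    other-side v∈U v∉Y with cover v∈U
    ... | inj₁ v∈Y = contradiction v∈Y v∉Y
    ... | inj₂ v∈Z = v∈Z

    separated : ∀ {y z} → y ∈ Y → z ∈ Z → y ≢ z
    separated y∈Y z∈Z refl = disjoint y∈Y z∈Z

  join-sym : ∀ {U Y Z} → Join U Y Z → Join U Z Y
  join-sym J = record
    { Y⊆U = Z⊆U ; Z⊆U = Y⊆U ; cover = swap ∘ cover
    ; disjoint = λ z∈Z z∈Y → disjoint z∈Y z∈Z
    ; complete = λ z∈Z y∈Y → ~-sym (complete y∈Y z∈Z)
    }
    where open Join J

  join-mixed-dominates : ∀ {U Y Z D y z} → Join U Y Z →
                         y ∈ Y → y ∈ D → z ∈ Z → z ∈ D → DominatesIn U D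
  join-mixed-dominates J y∈Y y∈D z∈Z z∈D v v∈U with Join.cover J v∈U
  ... | inj₁ v∈Y = inj₂ (_ , Join.complete J v∈Y z∈Z , z∈D)
  ... | inj₂ v∈Z = inj₂ (_ , ~-sym (Join.complete J y∈Y v∈Z) , y∈D)

  join-side-dominates : ∀ {U Y Z D} → Join U Y Z → Nonempty Y → D ⊆ Y →
                        DominatesIn U D ⇔ DominatesIn Y D
  join-side-dominates {D = D} J Y≠∅ D⊆Y = mk⇔ (dominates-restrict Y⊆U) extend
    where
      open Join J
      extend : DominatesIn _ D → DominatesIn _ D
      extend dom v v∈U with cover v∈U | dominating-nonempty Y≠∅ dom
      ... | inj₁ v∈Y | _         = dom v v∈Y
      ... | inj₂ v∈Z | d , d∈D   = inj₂ (d , ~-sym (complete (D⊆Y d∈D) v∈Z) , d∈D)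

  join-side-asummable : ∀ {U Y Z} → Join U Y Z → Nonempty Y → TwoAsummableIn U → TwoAsummableIn Y
  join-side-asummable J Y≠∅ = asummable-transfer (λ D → D) (λ _ → 0) (Join.Y⊆U J ∘_)
    (join-side-dominates J Y≠∅) (λ {D} _ i → ≡-sym (+-identityʳ (χ D i)))

  PairsDominate : Subset n → Set
  PairsDominate Z = ∀ z₁ z₂ → z₁ ∈ Z → z₂ ∈ Z → z₁ ≢ z₂ → DominatesIn Z (⁅ z₁ ⁆ ∪ ⁅ z₂ ⁆)

  pairs-dominate? : ∀ Z → Dec (PairsDominate Z)
  pairs-dominate? Z = all? λ z₁ → all? λ z₂ →
    (z₁ ∈? Z) →-dec (z₂ ∈? Z) →-dec ¬? (z₁ Fin.≟ z₂) →-dec dominates-in? Z (⁅ z₁ ⁆ ∪ ⁅ z₂ ⁆)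

  pair-exchange : ∀ {U Y Z y₁ y₂ z₁ z₂} → Join U Y Z →
    y₁ ∈ Y → y₂ ∈ Y → y₁ ≢ y₂ → ¬ DominatesIn Y (⁅ y₁ ⁆ ∪ ⁅ y₂ ⁆) →
    z₁ ∈ Z → z₂ ∈ Z → z₁ ≢ z₂ → ¬ DominatesIn Z (⁅ z₁ ⁆ ∪ ⁅ z₂ ⁆) → Exchange U
  pair-exchange {y₁ = y₁} {y₂} {z₁} {z₂} J y₁∈Y y₂∈Y y₁≢y₂ fails-Y z₁∈Z z₂∈Z z₁≢z₂ fails-Z =
    record
    { A₁ = ⁅ y₁ ⁆ ∪ ⁅ y₂ ⁆ ; A₂ = ⁅ z₁ ⁆ ∪ ⁅ z₂ ⁆ ; B₁ = ⁅ y₁ ⁆ ∪ ⁅ z₁ ⁆ ; B₂ = ⁅ y₂ ⁆ ∪ ⁅ z₂ ⁆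
    ; A₁⊆U = pair-⊆ (Y⊆U y₁∈Y) (Y⊆U y₂∈Y) ; A₂⊆U = pair-⊆ (Z⊆U z₁∈Z) (Z⊆U z₂∈Z)
    ; B₁⊆U = pair-⊆ (Y⊆U y₁∈Y) (Z⊆U z₁∈Z) ; B₂⊆U = pair-⊆ (Y⊆U y₂∈Y) (Z⊆U z₂∈Z)
    ; A₁-fails = fails-Y ∘ dominates-restrict Y⊆U
    ; A₂-fails = fails-Z ∘ dominates-restrict Z⊆U
    ; B₁-dominates = join-mixed-dominates J y₁∈Y (∈pair₁ y₁ z₁) z₁∈Z (∈pair₂ y₁ z₁)
    ; B₂-dominates = join-mixed-dominates J y₂∈Y (∈pair₁ y₂ z₂) z₂∈Z (∈pair₂ y₂ z₂)
    ; balanced = pair-balanced y₁≢y₂ z₁≢z₂ (separated y₁∈Y z₁∈Z) (separated y₂∈Y z₂∈Z)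
    }
    where open Join J

  pairs-dominate-one-side : ∀ {U Y Z} → TwoAsummableIn U → Join U Y Z →
                            PairsDominate Y ⊎ PairsDominate Z
  pairs-dominate-one-side {Y = Y} {Z} asm J with pairs-dominate? Z
  ... | yes pairs-Z = inj₂ pairs-Z
  ... | no ¬pairs-Z = inj₁ λ y₁ y₂ y₁∈Y y₂∈Y y₁≢y₂ →
    decidable-stable (dominates-in? Y _) λ fails-Y → ¬pairs-Z λ z₁ z₂ z₁∈Z z₂∈Z z₁≢z₂ →
    decidable-stable (dominates-in? Z _) λ fails-Z →
    asm (pair-exchange J y₁∈Y y₂∈Y y₁≢y₂ fails-Y z₁∈Z z₂∈Z z₁≢z₂ fails-Z)

  data Position (Y Z D : Subset n) : Set where
    within-Y    : D ⊆ Y → Position Y Z D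
    across      : ∀ {y z} → y ∈ Y → y ∈ D → z ∈ Z → z ∈ D → Position Y Z D
    two-in-Z    : ∀ {z z′} → D ⊆ Z → z ∈ D → z′ ∈ D → z ≢ z′ → Position Y Z D
    single-in-Z : ∀ {z} → z ∈ Z → D ≡ ⁅ z ⁆ → Position Y Z D

  position-in-Z : ∀ {Y Z D z} → D ⊆ Z → z ∈ D → Position Y Z D
  position-in-Z {D = D} {z} D⊆Z z∈D with any? (λ z′ → (z′ ∈? D) ×-dec ¬? (z′ Fin.≟ z))
  ... | yes (z′ , z′∈D , z′≢z) = two-in-Z D⊆Z z∈D z′∈D (≢-sym z′≢z)
  ... | no only-z = single-in-Z (D⊆Z z∈D) (⊆-antisym D⊆⁅z⁆ (⁅⁆-⊆ z∈D))
    where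
      D⊆⁅z⁆ : D ⊆ ⁅ z ⁆
      D⊆⁅z⁆ {x} x∈D =
        from x∈⁅y⁆⇔x≡y (decidable-stable (x Fin.≟ z) λ x≢z → only-z (x , x∈D , x≢z))

  position : ∀ {U Y Z D} → Join U Y Z → D ⊆ U → Position Y Z D
  position {Y = Y} {D = D} J D⊆U with any? (λ z → (z ∈? D) ×-dec ¬? (z ∈? Y))
  ... | no none = within-Y λ {x} x∈D → decidable-stable (x ∈? Y) λ x∉Y → none (x , x∈D , x∉Y)
  ... | yes (z , z∈D , z∉Y) with any? (λ y → (y ∈? D) ×-dec (y ∈? Y))
  ...   | yes (y , y∈D , y∈Y) = across y∈Y y∈D (Join.other-side J (D⊆U z∈D) z∉Y) z∈D
  ...   | no none-in-Y =
    position-in-Z (λ {x} x∈D → Join.other-side J (D⊆U x∈D) λ x∈Y → none-in-Y (x , x∈D , x∈Y)) z∈D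

  -- If t = 1 + m is the threshold
  -- of Y, a vertex of Y gets twice its weight, a vertex of Z gets 2t when it
  -- dominates G[Z] alone and 2t - 1 = m + t otherwise, and the new threshold is 2t.
  join-threshold : ∀ {U Y Z} → Join U Y Z → Nonempty Y → PairsDominate Z →
                   ThresholdIn Y → ThresholdIn U
  join-threshold {U} {Y} {Z} J Y≠∅ pairs T with ThresholdIn.threshold T | ThresholdIn.realises T
  ... | zero  | realises′ = contradiction (to (realises′ ⊥⊆) z≤n) (empty-fails Y≠∅)
  ... | suc m | realises′ =
    record { weight = w ; threshold = t + t ; positive = positive ; realises = realises }
    where
      open Join J
      open ThresholdIn T using () renaming (weight to w′; positive to positive′)
      t : ℕ
      t = suc m
      w : Fin n → ℕ
      w v = if does (v ∈? Y) then w′ v + w′ v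
            else if does (dominates-in? Z ⁅ v ⁆) then t + t else m + t

      w-Y : ∀ {v} → v ∈ Y → w v ≡ w′ v + w′ v
      w-Y {v} v∈Y rewrite dec-true (v ∈? Y) v∈Y = refl
      w-alone : ∀ {v} → v ∈ Z → DominatesIn Z ⁅ v ⁆ → w v ≡ t + t
      w-alone {v} v∈Z dom rewrite dec-false (v ∈? Y) (λ v∈Y → disjoint v∈Y v∈Z)
                                | dec-true (dominates-in? Z ⁅ v ⁆) dom = refl
      w-not-alone : ∀ {v} → v ∈ Z → ¬ DominatesIn Z ⁅ v ⁆ → w v ≡ m + t
      w-not-alone {v} v∈Z fails rewrite dec-false (v ∈? Y) (λ v∈Y → disjoint v∈Y v∈Z)
                                      | dec-false (dominates-in? Z ⁅ v ⁆) fails = refl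
      w-Z : ∀ {v} → v ∈ Z → m + t ≤ w v
      w-Z {v} v∈Z with dominates-in? Z ⁅ v ⁆
      ... | yes dom  = subst (m + t ≤_) (≡-sym (w-alone v∈Z dom)) (n≤1+n (m + t))
      ... | no fails = ≤-reflexive (≡-sym (w-not-alone v∈Z fails))

      positive : ∀ {v} → v ∈ U → 1 ≤ w v
      positive v∈U with cover v∈U
      ... | inj₁ v∈Y = subst (1 ≤_) (≡-sym (w-Y v∈Y)) (≤-trans (positive′ v∈Y) (m≤m+n _ _))
      ... | inj₂ v∈Z = ≤-trans (≤-trans (s≤s z≤n) (m≤n+m t m)) (w-Z v∈Z)

      -- Inside Y the weights are doubled, and so is the threshold.
      within-Y-realises : ∀ {D} → D ⊆ Y → wsum w D ≥ t + t ⇔ DominatesIn U D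
      within-Y-realises {D} D⊆Y =
        ⇔-trans doubling (⇔-trans (realises′ D⊆Y) (⇔-sym (join-side-dominates J Y≠∅ D⊆Y)))
        where
          doubled : wsum w D ≡ wsum w′ D + wsum w′ D
          doubled = trans (wsum-cong D (w-Y ∘ D⊆Y)) (wsum-+ w′ w′ D)
          doubling : wsum w D ≥ t + t ⇔ wsum w′ D ≥ t
          doubling = mk⇔ (λ heavy → half-≤ (subst (t + t ≤_) doubled heavy))
                         (λ heavy → subst (t + t ≤_) (≡-sym doubled) (+-mono-≤ heavy heavy))

      -- A vertex of Y (weight ≥ 1) with one of Z (weight ≥ 2t - 1) reaches 2t.
      across-heavy : ∀ {D y z} → y ∈ Y → y ∈ D → z ∈ Z → z ∈ D → wsum w D ≥ t + t
      across-heavy y∈Y y∈D z∈Z z∈D =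
        ≤-trans (+-mono-≤ (positive (Y⊆U y∈Y)) (w-Z z∈Z)) (wsum-two w (separated y∈Y z∈Z) y∈D z∈D)

      two-heavy : ∀ {D z z′} → z ∈ Z → z′ ∈ Z → z ≢ z′ → z ∈ D → z′ ∈ D → wsum w D ≥ t + t
      two-heavy z∈Z z′∈Z z≢z′ z∈D z′∈D = ≤-trans (+-mono-≤ (m≤n+m t m) (m≤n+m t m))
        (≤-trans (+-mono-≤ (w-Z z∈Z) (w-Z z′∈Z)) (wsum-two w z≢z′ z∈D z′∈D))

      alone : ∀ {z} → z ∈ Z → DominatesIn U ⁅ z ⁆ ⇔ DominatesIn Z ⁅ z ⁆
      alone z∈Z = join-side-dominates (join-sym J) (_ , z∈Z) (⁅⁆-⊆ z∈Z)
      single-realises : ∀ {z} → z ∈ Z → wsum w ⁅ z ⁆ ≥ t + t ⇔ DominatesIn U ⁅ z ⁆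
      single-realises {z} z∈Z with dominates-in? Z ⁅ z ⁆
      ... | yes dom  =
        both-hold (≤-reflexive (≡-sym (trans (wsum-⁅⁆ w z) (w-alone z∈Z dom)))) (from (alone z∈Z) dom)
      ... | no fails = neither-holds (<⇒≱ light) (fails ∘ to (alone z∈Z))
        where
          light : wsum w ⁅ z ⁆ < t + t
          light = subst (_< t + t) (≡-sym (trans (wsum-⁅⁆ w z) (w-not-alone z∈Z fails)))
                        (n<1+n (m + t))

      realises : ∀ {D} → D ⊆ U → wsum w D ≥ t + t ⇔ DominatesIn U D
      realises D⊆U with position J D⊆U
      ... | within-Y D⊆Y = within-Y-realises D⊆Y
      ... | across y∈Y y∈D z∈Z z∈D =
        both-hold (across-heavy y∈Y y∈D z∈Z z∈D) (join-mixed-dominates J y∈Y y∈D z∈Z z∈D)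
      ... | two-in-Z D⊆Z z∈D z′∈D z≢z′ =
        both-hold (two-heavy (D⊆Z z∈D) (D⊆Z z′∈D) z≢z′ z∈D z′∈D)
                  (from (join-side-dominates (join-sym J) (_ , D⊆Z z∈D) D⊆Z)
                        (dominates-mono (pair-⊆ z∈D z′∈D) (pairs _ _ (D⊆Z z∈D) (D⊆Z z′∈D) z≢z′)))
      ... | single-in-Z z∈Z refl = single-realises z∈Z


  empty-threshold : ∀ {U} → ¬ Nonempty U → ThresholdIn U
  empty-threshold U=∅ = record
    { weight = λ _ → 1 ; threshold = 0 ; positive = λ _ → ≤-refl
    ; realises = λ _ → both-hold z≤n λ v v∈U → contradiction (v , v∈U) U=∅ }

  side-⊂ : ∀ {U Y Z} → Join U Y Z → Nonempty Z → Y ⊂ U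
  side-⊂ J (z , z∈Z) = Y⊆U , z , Z⊆U z∈Z , λ z∈Y → disjoint z∈Y z∈Z
    where open Join J

  ThresholdBelow : Subset n → Set
  ThresholdBelow U = ∀ {V} → V ⊂ U → TwoAsummableIn V → ThresholdIn V

  join-case : ∀ {U Y Z} → Join U Y Z → Nonempty Y → Nonempty Z →
              TwoAsummableIn U → ThresholdBelow U → ThresholdIn U
  join-case J Y≠∅ Z≠∅ asm below with pairs-dominate-one-side asm J
  ... | inj₁ pairs-Y = join-threshold (join-sym J) Z≠∅ pairs-Y
                         (below (side-⊂ (join-sym J) Y≠∅) (join-side-asummable (join-sym J) Z≠∅ asm))
  ... | inj₂ pairs-Z = join-threshold J Y≠∅ pairs-Z
                         (below (side-⊂ J Z≠∅) (join-side-asummable J Y≠∅ asm))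

  pivot-join : ∀ {U u} → u ∈ U → Pivot U u → Join U (U ∩ ∁ (N u)) (U ∩ N u)
  pivot-join {U} {u} u∈U pivot = record
    { Y⊆U = proj₁ ∘ x∈p∩q⁻ U (∁ (N u)) ; Z⊆U = proj₁ ∘ x∈p∩q⁻ U (N u)
    ; cover = cover
    ; disjoint = λ v∈Y v∈Z → x∈∁p⇒x∉p (proj₂ (x∈p∩q⁻ U _ v∈Y)) (proj₂ (x∈p∩q⁻ U _ v∈Z))
    ; complete = complete
    }
    where
      cover : ∀ {v} → v ∈ U → v ∈ U ∩ ∁ (N u) ⊎ v ∈ U ∩ N u
      cover {v} v∈U with u ~? v
      ... | yes u~v = inj₂ (x∈p∩q⁺ (v∈U , ∈N⁺ u~v))
      ... | no u≁v  = inj₁ (x∈p∩q⁺ (v∈U , x∉p⇒x∈∁p (u≁v ∘ ∈N⁻)))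
      complete : ∀ {s r} → s ∈ U ∩ ∁ (N u) → r ∈ U ∩ N u → s ~ r
      complete {s} s∈Y r∈Z with x∈p∩q⁻ U _ s∈Y | x∈p∩q⁻ U _ r∈Z | s Fin.≟ u
      ... | _ , _ | _ , r∈N | yes refl = ∈N⁻ r∈N
      ... | s∈U , s∈∁N | r∈U , r∈N | no s≢u =
        pivot s∈U s≢u (x∈∁p⇒x∉p s∈∁N ∘ ∈N⁺) r∈U (∈N⁻ r∈N)

  pivot-case : ∀ {U u} → u ∈ U → Pivot U u → TwoAsummableIn U → ThresholdBelow U → ThresholdIn U
  pivot-case {U} {u} u∈U pivot asm below with any? (λ r → (r ∈? U) ×-dec (u ~? r))
  ... | yes (r , r∈U , u~r) = join-case (pivot-join u∈U pivot)
    (u , x∈p∩q⁺ (u∈U , x∉p⇒x∈∁p (~-irrefl ∘ ∈N⁻))) (r , x∈p∩q⁺ (r∈U , ∈N⁺ u~r)) asm below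
  ... | no no-neighbour =
    isolated-threshold u∈U isolated (below (x∈p⇒p-x⊂p u∈U) (isolated-asummable u∈U isolated asm))
    where
      isolated : Isolated U u
      isolated v∈U u~v = no-neighbour (_ , v∈U , u~v)

  asummable⇒threshold : ∀ {U} → TwoAsummableIn U → ThresholdIn U
  asummable⇒threshold = induction (⊂-wellFounded _)
    where
      induction : ∀ {U} → Acc _⊂_ U → TwoAsummableIn U → ThresholdIn U
      induction {U} (acc smaller) asm with nonempty? U
      ... | no U=∅ = empty-threshold U=∅
      ... | yes (u₀ , u₀∈U) with pivot-exists asm u₀∈U
      ...   | u , u∈U , pivot = pivot-case u∈U pivot asm λ V⊂U → induction (smaller V⊂U)


  dominating⇔in-⊤ : ∀ {D} → Dominating G D ⇔ DominatesIn ⊤ D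
  dominating⇔in-⊤ = mk⇔ (λ dom v _ → dom v) (λ dom v → dom v ∈⊤)

  minimal-dominating : ∀ {D} → Dominating G D → ∃[ E ] (MinimalDominating G E × E ⊆ D)
  minimal-dominating = shrink (⊂-wellFounded _)
    where
      shrink : ∀ {D} → Acc _⊂_ D → Dominating G D → ∃[ E ] (MinimalDominating G E × E ⊆ D)
      shrink {D} (acc smaller) dom with any? (λ x → (x ∈? D) ×-dec all? (dominated? (D - x)))
      ... | yes (x , x∈D , dom′) with shrink (smaller (x∈p⇒p-x⊂p x∈D)) dom′
      ...   | E , minimal , E⊆D-x = E , minimal , p─q⊆p D ⁅ x ⁆ ∘ E⊆D-x
      shrink {D} (acc smaller) dom | no irreducible = D , (dom , minimal) , λ x∈D → x∈D
        where
          minimal : ∀ D′ → D′ ⊆ D → Dominating G D′ → D′ ≡ D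
          -- A dominating D′ ⊆ D missing some x ∈ D would make D - x dominating.
          minimal D′ D′⊆D dom′ = ⊆-antisym D′⊆D λ {x} x∈D → decidable-stable (x ∈? D′) λ x∉D′ →
            irreducible (x , x∈D , λ v → dominated-mono (D′⊆D-x x∉D′) (dom′ v))
            where
              D′⊆D-x : ∀ {x} → x ∉ D′ → D′ ⊆ D - x
              D′⊆D-x x∉D′ y∈D′ = x∈p∧x≢y⇒x∈p-y (D′⊆D y∈D′) λ { refl → x∉D′ y∈D′ }

  dependent⇔dominating : ∀ X → Dependent (𝒟 G) X ⇔ Dominating G X
  dependent⇔dominating X = mk⇔ (λ (E , (domE , _) , E⊆X) v → dominated-mono E⊆X (domE v)) minimal-dominating

  domishold⇔threshold : Domishold G ⇔ Threshold (𝒟 G)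
  domishold⇔threshold = mk⇔
    (λ (w , t , realises) → w , t , λ X → ⇔-trans (realises X) (⇔-sym (dependent⇔dominating X)))
    (λ (w , t , realises) → w , t , λ X → ⇔-trans (realises X) (dependent⇔dominating X))

  asummable-in-⊤ : TwoAsummable (𝒟 G) → TwoAsummableIn ⊤
  asummable-in-⊤ asm ex = asm (A₁ , A₂ , B₁ , B₂ , independent A₁-fails , independent A₂-fails
                              , dependent B₁-dominates , dependent B₂-dominates , balanced)
    where
      open Exchange ex
      independent : ∀ {A} → ¬ DominatesIn ⊤ A → Independent (𝒟 G) A
      independent fails = fails ∘ to dominating⇔in-⊤ ∘ to (dependent⇔dominating _)
      dependent : ∀ {B} → DominatesIn ⊤ B → Dependent (𝒟 G) B
      dependent = from (dependent⇔dominating _) ∘ from dominating⇔in-⊤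

  threshold-in-⊤⇒domishold : ThresholdIn ⊤ → Domishold G
  threshold-in-⊤⇒domishold T = weight , threshold , λ X → ⇔-trans (realises ⊆⊤) (⇔-sym dominating⇔in-⊤)
    where open ThresholdIn T

-- (2) ⇒ (3) for every hypergraph: two independent sets weigh less than 2t in
-- total, two dependent sets at least 2t, yet balanced families weigh the same.
threshold⇒2-asummable : ∀ {n} (H : Hypergraph n) → Threshold H → TwoAsummable H
threshold⇒2-asummable H (w , t , realises) (A₁ , A₂ , B₁ , B₂ , ind₁ , ind₂ , dep₁ , dep₂ , bal) =
  <⇒≱ light heavy
  where
    light : wsum w A₁ + wsum w A₂ < t + t
    light = +-mono-< (≰⇒> (ind₁ ∘ to (realises A₁))) (≰⇒> (ind₂ ∘ to (realises A₂)))
    heavy : t + t ≤ wsum w A₁ + wsum w A₂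
    heavy = subst (t + t ≤_) (≡-sym (wsum-balanced w A₁ A₂ B₁ B₂ bal))
                  (+-mono-≤ (from (realises B₁) dep₁) (from (realises B₂) dep₂))

theorem3p7 : ∀ {n : ℕ} (G : Graph n) →
    (Domishold G ⇔ Threshold (𝒟 G)) × (Threshold (𝒟 G) ⇔ TwoAsummable (𝒟 G))
theorem3p7 G = domishold⇔threshold G , mk⇔ (threshold⇒2-asummable (𝒟 G)) asummable⇒threshold-𝒟
  where
    asummable⇒threshold-𝒟 : TwoAsummable (𝒟 G) → Threshold (𝒟 G)
    asummable⇒threshold-𝒟 = to (domishold⇔threshold G) ∘ threshold-in-⊤⇒domishold G
                           ∘ asummable⇒threshold G ∘ asummable-in-⊤ G
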